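{- Let $G_0$ be a graph and $A\subseteq V\subseteq V(G_0)$. If $A$ is closed in $G_0|V$ and $V$ is closed in $G_0$, then $A$ is closed in $G_0$.
   Context: Graphs are simple and undirected; $G_0|V$ is the subgraph of $G_0$ induced by $V$. A vertex set $A$ of a graph $G$ is closed in $G$ if there is no vertex $v\in V(G)\setminus A$ having at least $5/9$ of its neighbors (in $G$) in $A$. -}

module Defs where

open import Data.Nat using (ℕ; _*_; _≤_)
open import Data.Bool using (Bool; true; false; _∧_)
open import Data.Fin using (Fin)
open import Data.Fin.Subset using (Subset; _∈_; _∉_; _⊆_; _∩_; ∣_∣)
open import Data.Vec using (tabulate)
open import Relation.Binary.PropositionalEquality using (_≡_)
open import Relation.Nullary using (¬_)

record Graph (n : ℕ) : Set where
  field
    adj   : Fin n → Fin n → Bool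
    sym   : ∀ u v → adj u v ≡ adj v u
    irrefl : ∀ v → adj v v ≡ false

open Graph public

N : ∀ {n} → Graph n → Fin n → Subset n
N G v = tabulate (λ u → adj G v u)

N[_] : ∀ {n} → Subset n → Graph n → Fin n → Subset n
N[ V ] G v = N G v ∩ V

Closed : ∀ {n} → Graph n → Subset n → Set
Closed G A = ∀ v → v ∉ A → ¬ (5 * ∣ N G v ∣ ≤ 9 * ∣ N G v ∩ A ∣)

-- A is closed in the induced subgraph G|V (vertices of G|V are those of V;
-- neighbourhoods are taken inside V).
ClosedIn : ∀ {n} → Graph n → (V A : Subset n) → Set
ClosedIn G V A = ∀ v → v ∈ V → v ∉ A →
  ¬ (5 * ∣ N[ V ] G v ∣ ≤ 9 * ∣ N[ V ] G v ∩ A ∣)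

module Submission where

open import Defs
open import Data.Nat using (ℕ; _*_; _≤_)
open import Data.Nat.Properties using (≤-trans; *-monoʳ-≤)
open import Data.Fin.Subset using (Subset; _⊆_; _∩_; ∣_∣)
open import Data.Fin.Subset.Properties
  using (p⊆q⇒∣p∣≤∣q∣; ∣p∩q∣≤∣p∣; _∈?_; x∈p∩q⁺; x∈p∩q⁻)
open import Data.Product using (_,_)
open import Relation.Nullary using (yes; no)

-- A vertex v ∉ A violating closedness of A in G₀ either lies outside V, and then
-- has an even larger share of its neighbours in V ⊇ A, or lies in V, and then
-- discarding its neighbours outside V only raises the share lying in A.

Share≥ : ∀ {n} → ℕ → ℕ → Subset n → Subset n → Set
Share≥ p q S B = p * ∣ S ∣ ≤ q * ∣ S ∩ B ∣

∩-monoʳ-⊆ : ∀ {n} (S : Subset n) {B C : Subset n} → B ⊆ C → S ∩ B ⊆ S ∩ C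
∩-monoʳ-⊆ S {B} B⊆C x∈S∩B with x∈p∩q⁻ S B x∈S∩B
... | x∈S , x∈B = x∈p∩q⁺ (x∈S , B⊆C x∈B)

∩-restrict-⊆ : ∀ {n} (S : Subset n) {A V : Subset n} → A ⊆ V → S ∩ A ⊆ (S ∩ V) ∩ A
∩-restrict-⊆ S {A} A⊆V x∈S∩A with x∈p∩q⁻ S A x∈S∩A
... | x∈S , x∈A = x∈p∩q⁺ (x∈p∩q⁺ (x∈S , A⊆V x∈A) , x∈A)

share≥-monoʳ : ∀ {n p q} (S : Subset n) {B C : Subset n} →
  B ⊆ C → Share≥ p q S B → Share≥ p q S C
share≥-monoʳ {q = q} S B⊆C share =
  ≤-trans share (*-monoʳ-≤ q (p⊆q⇒∣p∣≤∣q∣ (∩-monoʳ-⊆ S B⊆C)))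

share≥-restrict : ∀ {n p q} (S : Subset n) {A V : Subset n} →
  A ⊆ V → Share≥ p q S A → Share≥ p q (S ∩ V) A
share≥-restrict {p = p} {q} S {V = V} A⊆V share =
  ≤-trans (*-monoʳ-≤ p (∣p∩q∣≤∣p∣ S V))
    (≤-trans share (*-monoʳ-≤ q (p⊆q⇒∣p∣≤∣q∣ (∩-restrict-⊆ S A⊆V))))

lemma4 : ∀ {n} (G₀ : Graph n) (A V : Subset n) → A ⊆ V →
    ClosedIn G₀ V A → Closed G₀ V → Closed G₀ A
lemma4 G₀ A V A⊆V A-closed-in-V V-closed v v∉A share with v ∈? V
... | no v∉V  = V-closed v v∉V (share≥-monoʳ {p = 5} {q = 9} (N G₀ v) A⊆V share)
... | yes v∈V = A-closed-in-V v v∈V v∉A (share≥-restrict {p = 5} {q = 9} (N G₀ v) A⊆V share)
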